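{- Let $E$ be a finite nonempty set, $f:2^E\to\mathbb{N}$ an integral polymatroid rank function, $d\in\mathbb{N}$ with $\mathbb{B}_f(d)\neq\emptyset$, and $C_e:\mathbb{N}\times\mathbb{N}\to\mathbb{R}_+$ regular for each $e\in E$. For $\mathbf{t}\in\mathbb{N}^E$ let $P(\mathbf{t},d)$ denote the problem of minimizing $\sum_{e\in E}C_e(x_e;t_e)$ over $\mathbf{x}\in\mathbb{B}_f(d)$. Then for every optimal solution $\mathbf{x}^*(\mathbf{t},d)$ of $P(\mathbf{t},d)$ and every $\mathbf{t}'\in\mathbb{N}^E$ with $\|\mathbf{t}-\mathbf{t}'\|_1=1$, there is an optimal solution $\mathbf{x}^*(\mathbf{t}',d)$ of $P(\mathbf{t}',d)$ with $\|\mathbf{x}^*(\mathbf{t},d)-\mathbf{x}^*(\mathbf{t}',d)\|_1\le 2$.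
   Context: An integral polymatroid rank function is a submodular, monotone, normalized ($f(\emptyset)=0$) set function $f:2^E\to\mathbb{N}$. $x(U)=\sum_{e\in U}x_e$; $\mathbb{B}_f(d)=\{\mathbf{x}\in\mathbb{N}^E: x(U)\le f(U)\ \forall U\subseteq E,\ x(E)=d\}$. $\|\cdot\|_1$ is the $L_1$-norm. For $C:\mathbb{N}\times\mathbb{N}\to\mathbb{R}$, $C^-(x;t)=C(x;t)-C(x-1;t)$ for $x\ge1$. $C$ is regular if $C^-(x;t)\le C^-(x;t+1)$ and $C^-(x;t+1)\le C^-(x+1;t)$ for all $x,t\in\mathbb{N}$ (where defined). -}

module Defs where

open import Level using (Level; _⊔_)
open import Data.Nat as ℕ using (ℕ; zero; ∣_-_∣)
open import Data.Fin using (Fin; zero; suc)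
open import Data.Fin.Subset using (Subset; _∪_; _∩_; _⊆_; ⊥; ⊤; inside; outside)
open import Data.Vec using (Vec; []; _∷_)
open import Data.Product using (_×_)
open import Relation.Binary.PropositionalEquality using (_≡_)
open import Algebra.Structures using (IsAbelianGroup)
open import Relation.Binary.Structures using (IsTotalOrder)

-- Agda has no reals, so
-- we work over an arbitrary totally ordered abelian group, of which
-- (ℝ, +, ≤) is an instance.

record OrderedAbelianGroup (c ℓ : Level) : Set (Level.suc (c ⊔ ℓ)) where
  infixl 6 _+_ _-_
  infix 4 _≤_
  field
    Carrier        : Set c
    _+_            : Carrier → Carrier → Carrier
    0#             : Carrier
    -_             : Carrier → Carrier
    _≤_            : Carrier → Carrier → Set ℓ
    isAbelianGroup : IsAbelianGroup _≡_ _+_ 0# -_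
    isTotalOrder   : IsTotalOrder _≡_ _≤_
    +-monoˡ-≤      : ∀ {x y} z → x ≤ y → x + z ≤ y + z
  _-_ : Carrier → Carrier → Carrier
  x - y = x + (- y)

xSum : ∀ {n} → (Fin n → ℕ) → Subset n → ℕ
xSum {zero}  x []            = 0
xSum {ℕ.suc n} x (inside ∷ U)  = x zero ℕ.+ xSum (λ i → x (suc i)) U
xSum {ℕ.suc n} x (outside ∷ U) = xSum (λ i → x (suc i)) U

dist₁ : ∀ {n} → (Fin n → ℕ) → (Fin n → ℕ) → ℕ
dist₁ {zero}    x y = 0
dist₁ {ℕ.suc n} x y = ∣ x zero - y zero ∣ ℕ.+ dist₁ (λ i → x (suc i)) (λ i → y (suc i))

IsPolymatroidRank : ∀ {n} → (Subset n → ℕ) → Set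
IsPolymatroidRank {n} f =
  (f ⊥ ≡ 0) ×
  (∀ (A B : Subset n) → A ⊆ B → f A ℕ.≤ f B) ×
  (∀ (A B : Subset n) → f (A ∪ B) ℕ.+ f (A ∩ B) ℕ.≤ f A ℕ.+ f B)

InBase : ∀ {n} → (Subset n → ℕ) → ℕ → (Fin n → ℕ) → Set
InBase {n} f d x = (∀ (U : Subset n) → xSum x U ℕ.≤ f U) × (xSum x ⊤ ≡ d)

module _ {c ℓ} (G : OrderedAbelianGroup c ℓ) where
  open OrderedAbelianGroup G

  -- C⁻(x;t) = C(x;t) − C(x−1;t), for x ≥ 1 (written with x = suc y)
  Cminus : (ℕ → ℕ → Carrier) → ℕ → ℕ → Carrier
  Cminus C y t = C (ℕ.suc y) t - C y t

  Regular : (ℕ → ℕ → Carrier) → Set ℓ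
  Regular C = ∀ (y t : ℕ) →
    (Cminus C y t ≤ Cminus C y (ℕ.suc t)) ×
    (Cminus C y (ℕ.suc t) ≤ Cminus C (ℕ.suc y) t)

  Nonneg : (ℕ → ℕ → Carrier) → Set ℓ
  Nonneg C = ∀ (x t : ℕ) → 0# ≤ C x t

  gsum : ∀ {n} → (Fin n → Carrier) → Carrier
  gsum {zero}    a = 0#
  gsum {ℕ.suc n} a = a zero + gsum (λ i → a (suc i))

  cost : ∀ {n} → (Fin n → ℕ → ℕ → Carrier) → (Fin n → ℕ) → (Fin n → ℕ) → Carrier
  cost C t x = gsum (λ e → C e (x e) (t e))

  Optimal : ∀ {n} → (Subset n → ℕ) → ℕ → (Fin n → ℕ → ℕ → Carrier) →
            (Fin n → ℕ) → (Fin n → ℕ) → Set ℓ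
  Optimal f d C t x = InBase f d x × (∀ y → InBase f d y → cost C t x ≤ cost C t y)

module Submission where

-- Write t′ = t ± χ_e. If x is optimal at times t, w is feasible and, coordinatewise,
--   C_v(w_v; t_v) + C_v(z_v; t′_v) ≤ C_v(x_v; t_v) + C_v(y_v; t′_v),
-- then summing and cancelling cost_t(x) ≤ cost_t(w) shows that z costs at most as much
-- as y at times t′. For a feasible y with y_e = x_e take z = x, w = y. Otherwise the
-- exchange property of polymatroid bases gives g such that z = x − χ_e + χ_g and
-- w = y + χ_e − χ_g (or the same with x and y swapped) are feasible; the coordinatewise
-- inequality holds at g by convexity of C_g and at e because regularity makes
-- k ↦ C_e(k+1; τ) − C_e(k; τ′) nondecreasing for adjacent times τ, τ′. So every feasible
-- y is matched by x or a unit transfer of x, and the cheapest of these at times t′ is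
-- optimal and within distance 2 of x.

open import Defs

module SubsetSums where

  open import Data.Nat using (ℕ; zero; suc; _+_; _≤_; _<_; z≤n)
  open import Data.Nat.Properties
  open import Algebra.Properties.CommutativeSemigroup +-commutativeSemigroup
    using (interchange; x∙yz≈y∙xz)
  open import Data.Fin using (Fin; zero; suc)
  open import Data.Fin.Subset using (Subset; _∈_; _∪_; _∩_; _─_; ⊥; inside; outside)
  open import Data.Vec using ([]; _∷_; here; there)
  open import Function using (_∘_)
  open import Relation.Binary.PropositionalEquality

  private
    variable
      m : ℕ
      p q x : Fin m → ℕ
      U : Subset m
      u : Fin m

  xSum-cong : p ≗ q → xSum p U ≡ xSum q U
  xSum-cong {U = []}          p≗q = refl
  xSum-cong {U = inside ∷ U}  p≗q = cong₂ _+_ (p≗q zero) (xSum-cong (p≗q ∘ suc))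
  xSum-cong {U = outside ∷ U} p≗q = xSum-cong (p≗q ∘ suc)

  xSum-0 : ∀ (U : Subset m) → xSum (λ _ → 0) U ≡ 0
  xSum-0 []            = refl
  xSum-0 (inside ∷ U)  = xSum-0 U
  xSum-0 (outside ∷ U) = xSum-0 U

  xSum-⊥ : ∀ (x : Fin m → ℕ) → xSum x ⊥ ≡ 0
  xSum-⊥ {zero}  x = refl
  xSum-⊥ {suc m} x = xSum-⊥ (x ∘ suc)

  xSum-+ : ∀ (p q : Fin m → ℕ) U → xSum (λ w → p w + q w) U ≡ xSum p U + xSum q U
  xSum-+ p q []            = refl
  xSum-+ p q (inside ∷ U)  =
    trans (cong (p zero + q zero +_) (xSum-+ (p ∘ suc) (q ∘ suc) U))
          (interchange (p zero) (q zero) _ _)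
  xSum-+ p q (outside ∷ U) = xSum-+ (p ∘ suc) (q ∘ suc) U

  xSum-mono : (∀ w → w ∈ U → p w ≤ q w) → xSum p U ≤ xSum q U
  xSum-mono {U = []}          p≤q = z≤n
  xSum-mono {U = inside ∷ U}  p≤q = +-mono-≤ (p≤q zero here) (xSum-mono (λ w → p≤q (suc w) ∘ there))
  xSum-mono {U = outside ∷ U} p≤q = xSum-mono (λ w → p≤q (suc w) ∘ there)

  xSum-< : (∀ w → w ∈ U → p w ≤ q w) → u ∈ U → p u < q u → xSum p U < xSum q U
  xSum-< {U = inside ∷ U}  p≤q here        pu<qu =
    +-mono-<-≤ pu<qu (xSum-mono (λ w → p≤q (suc w) ∘ there))
  xSum-< {U = inside ∷ U}  p≤q (there u∈U) pu<qu =
    +-mono-≤-< (p≤q zero here) (xSum-< (λ w → p≤q (suc w) ∘ there) u∈U pu<qu)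
  xSum-< {U = outside ∷ U} p≤q (there u∈U) pu<qu =
    xSum-< (λ w → p≤q (suc w) ∘ there) u∈U pu<qu

  xSum-∪ : ∀ (T S : Subset m) → xSum x S + xSum x (T ─ S) ≡ xSum x (T ∪ S)
  xSum-∪ []            []            = refl
  xSum-∪ {x = x} (inside  ∷ T) (inside  ∷ S) =
    trans (+-assoc (x zero) _ _) (cong (x zero +_) (xSum-∪ T S))
  xSum-∪ {x = x} (inside  ∷ T) (outside ∷ S) =
    trans (x∙yz≈y∙xz (xSum (x ∘ suc) S) (x zero) _) (cong (x zero +_) (xSum-∪ T S))
  xSum-∪ {x = x} (outside ∷ T) (inside  ∷ S) =
    trans (+-assoc (x zero) _ _) (cong (x zero +_) (xSum-∪ T S))
  xSum-∪ (outside ∷ T) (outside ∷ S) = xSum-∪ T S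

  xSum-∩ : ∀ (T S : Subset m) → xSum x (T ∩ S) + xSum x (T ─ S) ≡ xSum x T
  xSum-∩ []            []            = refl
  xSum-∩ {x = x} (inside  ∷ T) (inside  ∷ S) =
    trans (+-assoc (x zero) _ _) (cong (x zero +_) (xSum-∩ T S))
  xSum-∩ {x = x} (inside  ∷ T) (outside ∷ S) =
    trans (x∙yz≈y∙xz (xSum (x ∘ suc) (T ∩ S)) (x zero) _) (cong (x zero +_) (xSum-∩ T S))
  xSum-∩ (outside ∷ T) (inside  ∷ S) = xSum-∩ T S
  xSum-∩ (outside ∷ T) (outside ∷ S) = xSum-∩ T S

  xSum-modular : ∀ (S T : Subset m) → xSum x (S ∪ T) + xSum x (S ∩ T) ≡ xSum x S + xSum x T
  xSum-modular {x = x} S T = begin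
    xSum x (S ∪ T) + xSum x (S ∩ T)                  ≡⟨ cong (_+ xSum x (S ∩ T)) (xSum-∪ S T) ⟨
    xSum x T + xSum x (S ─ T) + xSum x (S ∩ T)      ≡⟨ +-assoc (xSum x T) _ _ ⟩
    xSum x T + (xSum x (S ─ T) + xSum x (S ∩ T))    ≡⟨ cong (xSum x T +_) (+-comm _ (xSum x (S ∩ T))) ⟩
    xSum x T + (xSum x (S ∩ T) + xSum x (S ─ T))    ≡⟨ cong (xSum x T +_) (xSum-∩ S T) ⟩
    xSum x T + xSum x S                             ≡⟨ +-comm (xSum x T) _ ⟩
    xSum x S + xSum x T                             ∎
    where open ≡-Reasoning

module Transfers where

  open SubsetSums
  open import Data.Nat using (ℕ; zero; suc; _+_; _∸_; _≤_; _<_; z≤n; s≤s; ∣_-_∣)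
  open import Data.Nat.Properties hiding (_≟_)
  open import Data.Fin using (Fin; zero; suc; _≟_)
  open import Data.Fin.Subset using (Subset; _∈_; _∉_; ⊤; inside; outside)
  open import Data.Fin.Subset.Properties using (∈⊤)
  open import Data.Vec using (_∷_; here; there)
  open import Data.Empty using (⊥-elim)
  open import Function using (_∘_)
  open import Relation.Binary.PropositionalEquality
  open import Relation.Nullary using (yes; no)

  private
    variable
      m : ℕ
      x : Fin m → ℕ
      a b w : Fin m
      U : Subset m

  χ : Fin m → Fin m → ℕ
  χ zero    zero    = 1
  χ zero    (suc _) = 0
  χ (suc _) zero    = 0
  χ (suc a) (suc w) = χ a w

  χ-diag : ∀ (a : Fin m) → χ a a ≡ 1
  χ-diag zero    = refl
  χ-diag (suc a) = χ-diag a

  χ-off : a ≢ w → χ a w ≡ 0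
  χ-off {a = zero}  {zero}  a≢w = ⊥-elim (a≢w refl)
  χ-off {a = zero}  {suc w} a≢w = refl
  χ-off {a = suc a} {zero}  a≢w = refl
  χ-off {a = suc a} {suc w} a≢w = χ-off (a≢w ∘ cong suc)

  xSum-χ-∈ : a ∈ U → xSum (χ a) U ≡ 1
  xSum-χ-∈ {U = inside ∷ U}  here        = cong suc (xSum-0 U)
  xSum-χ-∈ {U = inside ∷ U}  (there a∈U) = xSum-χ-∈ a∈U
  xSum-χ-∈ {U = outside ∷ U} (there a∈U) = xSum-χ-∈ a∈U

  xSum-χ-∉ : a ∉ U → xSum (χ a) U ≡ 0
  xSum-χ-∉ {a = zero}  {inside ∷ U}  a∉U = ⊥-elim (a∉U here)
  xSum-χ-∉ {a = zero}  {outside ∷ U} a∉U = xSum-0 U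
  xSum-χ-∉ {a = suc a} {inside ∷ U}  a∉U = xSum-χ-∉ (a∉U ∘ there)
  xSum-χ-∉ {a = suc a} {outside ∷ U} a∉U = xSum-χ-∉ (a∉U ∘ there)

  -- x − χ_a + χ_b; adding before subtracting makes the truncated subtraction exact
  -- whenever x a ≥ 1.
  transfer : (Fin m → ℕ) → Fin m → Fin m → Fin m → ℕ
  transfer x a b w = x w + χ b w ∸ χ a w

  transfer-src : a ≢ b → transfer x a b a ≡ x a ∸ 1
  transfer-src {a = a} {b = b} {x = x} a≢b
    rewrite χ-off (a≢b ∘ sym) | χ-diag a | +-identityʳ (x a) = refl

  transfer-tgt : a ≢ b → transfer x a b b ≡ suc (x b)
  transfer-tgt {a = a} {b = b} {x = x} a≢b rewrite χ-off a≢b | χ-diag b = +-comm (x b) 1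

  transfer-other : w ≢ a → w ≢ b → transfer x a b w ≡ x w
  transfer-other {w = w} {x = x} w≢a w≢b
    rewrite χ-off (w≢a ∘ sym) | χ-off (w≢b ∘ sym) = +-identityʳ (x w)

  module TransferSums {m} (x : Fin m → ℕ) (a b : Fin m) (0<xa : 0 < x a) where

    xSum-transfer : ∀ U → xSum (transfer x a b) U + xSum (χ a) U ≡ xSum x U + xSum (χ b) U
    xSum-transfer U = begin
      xSum (transfer x a b) U + xSum (χ a) U       ≡⟨ xSum-+ (transfer x a b) (χ a) U ⟨
      xSum (λ w → transfer x a b w + χ a w) U      ≡⟨ xSum-cong restore ⟩
      xSum (λ w → x w + χ b w) U                   ≡⟨ xSum-+ x (χ b) U ⟩
      xSum x U + xSum (χ b) U                      ∎
      where
      open ≡-Reasoning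
      restore : ∀ w → transfer x a b w + χ a w ≡ x w + χ b w
      restore w with a ≟ w
      ... | yes refl rewrite χ-diag a = m∸n+n≡m (≤-trans 0<xa (m≤m+n (x a) (χ b a)))
      ... | no a≢w   rewrite χ-off a≢w = +-identityʳ _

    xSum-transfer-∉ : ∀ {U} → b ∉ U → xSum (transfer x a b) U ≤ xSum x U
    xSum-transfer-∉ {U} b∉U = m+n≤o⇒m≤o _ (begin
      xSum (transfer x a b) U + xSum (χ a) U    ≡⟨ xSum-transfer U ⟩
      xSum x U + xSum (χ b) U                   ≡⟨ cong (xSum x U +_) (xSum-χ-∉ b∉U) ⟩
      xSum x U + 0                              ≡⟨ +-identityʳ _ ⟩
      xSum x U                                  ∎)
      where open ≤-Reasoning

    xSum-transfer-∈∈ : ∀ {U} → a ∈ U → b ∈ U → xSum (transfer x a b) U ≡ xSum x U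
    xSum-transfer-∈∈ {U} a∈U b∈U = +-cancelʳ-≡ 1 _ _ (begin
      xSum (transfer x a b) U + 1               ≡⟨ cong (xSum (transfer x a b) U +_) (xSum-χ-∈ a∈U) ⟨
      xSum (transfer x a b) U + xSum (χ a) U    ≡⟨ xSum-transfer U ⟩
      xSum x U + xSum (χ b) U                   ≡⟨ cong (xSum x U +_) (xSum-χ-∈ b∈U) ⟩
      xSum x U + 1                              ∎)
      where open ≡-Reasoning

    xSum-transfer-∉∈ : ∀ {U} → a ∉ U → b ∈ U → xSum (transfer x a b) U ≡ suc (xSum x U)
    xSum-transfer-∉∈ {U} a∉U b∈U = begin
      xSum (transfer x a b) U                   ≡⟨ +-identityʳ _ ⟨
      xSum (transfer x a b) U + 0               ≡⟨ cong (xSum (transfer x a b) U +_) (xSum-χ-∉ a∉U) ⟨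
      xSum (transfer x a b) U + xSum (χ a) U    ≡⟨ xSum-transfer U ⟩
      xSum x U + xSum (χ b) U                   ≡⟨ cong (xSum x U +_) (xSum-χ-∈ b∈U) ⟩
      xSum x U + 1                              ≡⟨ +-comm _ 1 ⟩
      suc (xSum x U)                            ∎
      where open ≡-Reasoning

  ∣m-m∸n∣≤n : ∀ m n → ∣ m - m ∸ n ∣ ≤ n
  ∣m-m∸n∣≤n m       zero    = ≤-reflexive (∣n-n∣≡0 m)
  ∣m-m∸n∣≤n zero    (suc n) = z≤n
  ∣m-m∸n∣≤n (suc m) (suc n) = begin
    ∣ suc m - m ∸ n ∣              ≤⟨ ∣-∣-triangle (suc m) m (m ∸ n) ⟩
    ∣ suc m - m ∣ + ∣ m - m ∸ n ∣  ≡⟨ cong (_+ ∣ m - m ∸ n ∣) (m≤n⇒∣n-m∣≡n∸m (n≤1+n m)) ⟩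
    suc m ∸ m + ∣ m - m ∸ n ∣      ≡⟨ cong (_+ ∣ m - m ∸ n ∣) (m+n∸n≡m 1 m) ⟩
    suc ∣ m - m ∸ n ∣              ≤⟨ s≤s (∣m-m∸n∣≤n m n) ⟩
    suc n                          ∎
    where open ≤-Reasoning

  ∣m-m+n∸o∣≤o+n : ∀ m n o → ∣ m - m + n ∸ o ∣ ≤ o + n
  ∣m-m+n∸o∣≤o+n m n o = begin
    ∣ m - m + n ∸ o ∣                          ≤⟨ ∣-∣-triangle m (m + n) (m + n ∸ o) ⟩
    ∣ m - m + n ∣ + ∣ m + n - m + n ∸ o ∣      ≤⟨ +-mono-≤ (≤-reflexive (∣m-m+n∣≡n m n))
                                                              (∣m-m∸n∣≤n (m + n) o) ⟩
    n + o                                      ≡⟨ +-comm n o ⟩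
    o + n                                      ∎
    where open ≤-Reasoning

  dist₁-≤ : ∀ {m} {x z p : Fin m → ℕ} → (∀ w → ∣ x w - z w ∣ ≤ p w) → dist₁ x z ≤ xSum p ⊤
  dist₁-≤ {m = zero}  bound = z≤n
  dist₁-≤ {m = suc m} bound = +-mono-≤ (bound zero) (dist₁-≤ (bound ∘ suc))

  dist₁-refl : ∀ {m} (x : Fin m → ℕ) → dist₁ x x ≡ 0
  dist₁-refl {zero}  x = refl
  dist₁-refl {suc m} x rewrite ∣n-n∣≡0 (x zero) = dist₁-refl (x ∘ suc)

  dist₁-transfer : ∀ (x : Fin m → ℕ) a b → dist₁ x (transfer x a b) ≤ 2
  dist₁-transfer x a b = begin
    dist₁ x (transfer x a b)               ≤⟨ dist₁-≤ (λ w → ∣m-m+n∸o∣≤o+n (x w) (χ b w) (χ a w)) ⟩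
    xSum (λ w → χ a w + χ b w) ⊤           ≡⟨ xSum-+ (χ a) (χ b) ⊤ ⟩
    xSum (χ a) ⊤ + xSum (χ b) ⊤            ≡⟨ cong₂ _+_ (xSum-χ-∈ (∈⊤ {x = a}))
                                                         (xSum-χ-∈ (∈⊤ {x = b})) ⟩
    2                                      ∎
    where open ≤-Reasoning

module AdjacentTimes where

  open import Data.Nat using (ℕ; zero; suc; ∣_-_∣)
  open import Data.Nat.Properties using (∣m-n∣≡0⇒m≡n; m+n≡0⇒m≡0; m+n≡0⇒n≡0; suc-injective)
  open import Data.Fin using (Fin; zero; suc)
  open import Data.Product using (∃-syntax; _×_; _,_)
  open import Data.Empty using (⊥-elim)
  open import Function using (_∘_)
  open import Relation.Binary.PropositionalEquality

  private
    variable
      m : ℕ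

  data Adjacent : ℕ → ℕ → Set where
    same    : ∀ {τ} → Adjacent τ τ
    later   : ∀ {τ} → Adjacent τ (suc τ)
    earlier : ∀ {τ} → Adjacent (suc τ) τ

  Adjacent-sym : ∀ {τ τ′} → Adjacent τ τ′ → Adjacent τ′ τ
  Adjacent-sym same    = same
  Adjacent-sym later   = earlier
  Adjacent-sym earlier = later

  Adjacent-suc : ∀ {τ τ′} → Adjacent τ τ′ → Adjacent (suc τ) (suc τ′)
  Adjacent-suc same    = same
  Adjacent-suc later   = later
  Adjacent-suc earlier = earlier

  ∣m-n∣≡1⇒Adjacent : ∀ {τ τ′} → ∣ τ - τ′ ∣ ≡ 1 → Adjacent τ τ′
  ∣m-n∣≡1⇒Adjacent {zero}        {suc zero}    _ = later
  ∣m-n∣≡1⇒Adjacent {suc zero}    {zero}        _ = earlier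
  ∣m-n∣≡1⇒Adjacent {suc τ}       {suc τ′}      d≡1 = Adjacent-suc (∣m-n∣≡1⇒Adjacent d≡1)
  ∣m-n∣≡1⇒Adjacent {zero}        {zero}        ()
  ∣m-n∣≡1⇒Adjacent {zero}        {suc (suc _)} ()
  ∣m-n∣≡1⇒Adjacent {suc (suc _)} {zero}        ()

  dist₁≡0⇒≗ : ∀ (t t′ : Fin m → ℕ) → dist₁ t t′ ≡ 0 → ∀ w → t w ≡ t′ w
  dist₁≡0⇒≗ {suc m} t t′ d≡0 zero    = ∣m-n∣≡0⇒m≡n (m+n≡0⇒m≡0 _ d≡0)
  dist₁≡0⇒≗ {suc m} t t′ d≡0 (suc w) =
    dist₁≡0⇒≗ (t ∘ suc) (t′ ∘ suc) (m+n≡0⇒n≡0 ∣ t zero - t′ zero ∣ d≡0) w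

  dist₁≡1⇒unit-change : ∀ (t t′ : Fin m → ℕ) → dist₁ t t′ ≡ 1 →
                        ∃[ e ] Adjacent (t e) (t′ e) × (∀ w → w ≢ e → t w ≡ t′ w)
  dist₁≡1⇒unit-change {suc m} t t′ d≡1 with ∣ t zero - t′ zero ∣ in d₀
  ... | 0 with dist₁≡1⇒unit-change (t ∘ suc) (t′ ∘ suc) d≡1
  ...   | e , adjacent , agree = suc e , adjacent , agree′
    where
    agree′ : ∀ w → w ≢ suc e → t w ≡ t′ w
    agree′ zero    _   = ∣m-n∣≡0⇒m≡n d₀
    agree′ (suc w) w≢e = agree w (w≢e ∘ cong suc)
  dist₁≡1⇒unit-change {suc m} t t′ d≡1 | 1 = zero , ∣m-n∣≡1⇒Adjacent d₀ , agree
    where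
    agree : ∀ w → w ≢ zero → t w ≡ t′ w
    agree zero    w≢0 = ⊥-elim (w≢0 refl)
    agree (suc w) _   = dist₁≡0⇒≗ (t ∘ suc) (t′ ∘ suc) (suc-injective d≡1) w
  dist₁≡1⇒unit-change {suc m} t t′ () | suc (suc _)

module Polymatroid where

  open SubsetSums
  open Transfers
  open import Level using (Level)
  open import Data.Nat using (ℕ; zero; suc; _+_; _≤_; _<_; z≤n; s≤s)
  open import Data.Nat.Properties
  open import Algebra.Properties.CommutativeSemigroup +-commutativeSemigroup
    using (xy∙z≈xz∙y; xy∙z≈zx∙y)
  open import Data.Fin using (Fin; zero)
  open import Data.Fin.Properties using (any?)
  open import Data.Fin.Subset
    using (Subset; _∈_; _∉_; _⊆_; _∪_; _∩_; _─_; ⋃; ⋂; ⊤; ⊥; inside; outside)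
  open import Data.Fin.Subset.Properties
    using (_∈?_; ∉⊥; ∈⊤; x∈p∪q⁻; x∈p∩q⁺; x∈p∧x∉q⇒x∈p─q; drop-there;
           p⊆p∪q; q⊆p∪q; p∩q⊆p; p∩q⊆q; ∪-zeroˡ; ∩-identityˡ; ∩-identityʳ)
  open import Data.Bool using (Bool)
  open import Data.Vec using ([]; _∷_; here; there)
  import Data.Vec as Vec
  open import Data.List using (List; []; _∷_; cartesianProductWith; filter)
  open import Data.List.Membership.Propositional using () renaming (_∈_ to _∈ₗ_)
  open import Data.List.Membership.Propositional.Properties
    using (∈-cartesianProductWith⁺; ∈-filter⁺)
  open import Data.List.Relation.Unary.Any using (here; there)
  open import Data.List.Relation.Unary.All as All using (All; []; _∷_)
  open import Data.List.Relation.Unary.All.Properties using (all-filter)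
  open import Data.Product using (∃-syntax; _×_; _,_; proj₁; proj₂)
  import Data.Product as Product
  open import Data.Sum using (_⊎_; inj₁; inj₂; [_,_])
  open import Data.Empty using (⊥-elim)
  open import Function using (_∘_)
  open import Relation.Binary.PropositionalEquality hiding ([_])
  open import Relation.Nullary using (¬_; Dec; yes; no)
  open import Relation.Nullary.Decidable using (_×-dec_; ¬?; map′)
  open import Relation.Unary using (Pred)

  private
    variable
      ℓ : Level
      m : ℕ
      U : Subset m
      Us : List (Subset m)
      Q : Pred (Subset m) ℓ

  sides : List Bool
  sides = inside ∷ outside ∷ []

  subsets : ∀ m → List (Subset m)
  subsets zero    = [] ∷ []
  subsets (suc m) = cartesianProductWith Vec._∷_ sides (subsets m)

  ∈-subsets : ∀ (U : Subset m) → U ∈ₗ subsets m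
  ∈-subsets []      = here refl
  ∈-subsets (s ∷ U) = ∈-cartesianProductWith⁺ Vec._∷_ {xs = sides} (∈-sides s) (∈-subsets U)
    where
    ∈-sides : ∀ s → s ∈ₗ sides
    ∈-sides inside  = here refl
    ∈-sides outside = there (here refl)

  ⋃-preserves : ∀ (P : Pred (Subset m) ℓ) →
                P ⊥ → (∀ {A B} → Q A → P B → P (A ∪ B)) → All Q Us → P (⋃ Us)
  ⋃-preserves P p⊥ step []         = p⊥
  ⋃-preserves P p⊥ step (qA ∷ qUs) = step qA (⋃-preserves P p⊥ step qUs)

  ⋂-preserves : ∀ (P : Pred (Subset m) ℓ) →
                P ⊤ → (∀ {A B} → Q A → P B → P (A ∩ B)) → All Q Us → P (⋂ Us)
  ⋂-preserves P p⊤ step []         = p⊤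
  ⋂-preserves P p⊤ step (qA ∷ qUs) = step qA (⋂-preserves P p⊤ step qUs)

  ⊆-⋃ : U ∈ₗ Us → U ⊆ ⋃ Us
  ⊆-⋃ {Us = _ ∷ Us} (here refl)  = p⊆p∪q (⋃ Us)
  ⊆-⋃ {Us = A ∷ Us} (there U∈Us) = q⊆p∪q A (⋃ Us) ∘ ⊆-⋃ U∈Us

  ⋂-⊆ : U ∈ₗ Us → ⋂ Us ⊆ U
  ⋂-⊆ {Us = A ∷ Us} (here refl)  = p∩q⊆p A (⋂ Us)
  ⋂-⊆ {Us = A ∷ Us} (there U∈Us) = ⋂-⊆ U∈Us ∘ p∩q⊆q A (⋂ Us)

  x∈p─q⁻ : ∀ {w : Fin m} (p q : Subset m) → w ∈ p ─ q → w ∈ p × w ∉ q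
  x∈p─q⁻ {w = zero} (inside  ∷ p) (outside ∷ q) here = here , λ ()
  x∈p─q⁻ {w = zero} (inside  ∷ p) (inside  ∷ q) ()
  x∈p─q⁻ {w = zero} (outside ∷ p) (outside ∷ q) ()
  x∈p─q⁻ {w = zero} (outside ∷ p) (inside  ∷ q) ()
  x∈p─q⁻ (_ ∷ p) (_ ∷ q) (there w∈) =
    Product.map there (_∘ drop-there) (x∈p─q⁻ p q w∈)

  ≤-squeeze : ∀ {p P q Q} → p ≤ P → q ≤ Q → P + Q ≤ p + q → p ≡ P × q ≡ Q
  ≤-squeeze {p} {P} {q} {Q} p≤P q≤Q P+Q≤p+q =
    ≤-antisym p≤P (+-cancelʳ-≤ Q P p (≤-trans P+Q≤p+q (+-monoʳ-≤ p q≤Q))) ,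
    ≤-antisym q≤Q (+-cancelˡ-≤ P Q q (≤-trans P+Q≤p+q (+-monoˡ-≤ q p≤P)))

  module _ {m} (f : Subset m → ℕ) (polymatroid : IsPolymatroidRank f) where

    private
      f⊥≡0 : f ⊥ ≡ 0
      f⊥≡0 = proj₁ polymatroid

      submodular : ∀ A B → f (A ∪ B) + f (A ∩ B) ≤ f A + f B
      submodular = proj₂ (proj₂ polymatroid)

    Tight : (Fin m → ℕ) → Subset m → Set
    Tight x U = xSum x U ≡ f U

    tight-⊥ : ∀ (x : Fin m → ℕ) → Tight x ⊥
    tight-⊥ x = trans (xSum-⊥ x) (sym f⊥≡0)

    tight-∪∩ : ∀ {x A B} → (∀ U → xSum x U ≤ f U) → Tight x A → Tight x B →
               Tight x (A ∪ B) × Tight x (A ∩ B)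
    tight-∪∩ {x} {A} {B} x≤f tA tB = ≤-squeeze (x≤f (A ∪ B)) (x≤f (A ∩ B)) (begin
      f (A ∪ B) + f (A ∩ B)              ≤⟨ submodular A B ⟩
      f A + f B                          ≡⟨ cong₂ _+_ tA tB ⟨
      xSum x A + xSum x B                ≡⟨ xSum-modular A B ⟨
      xSum x (A ∪ B) + xSum x (A ∩ B)    ∎)
      where open ≤-Reasoning

    transfer-feasible : ∀ {d x a b} → InBase f d x → 0 < x a →
                        (∀ U → b ∈ U → a ∉ U → ¬ Tight x U) → InBase f d (transfer x a b)
    transfer-feasible {d} {x} {a} {b} (x≤f , x⊤≡d) 0<xa untight = ≤f , trans unchanged-⊤ x⊤≡d
      where
      open TransferSums x a b 0<xa
      unchanged-⊤ : xSum (transfer x a b) ⊤ ≡ xSum x ⊤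
      unchanged-⊤ = xSum-transfer-∈∈ ∈⊤ ∈⊤
      ≤f : ∀ U → xSum (transfer x a b) U ≤ f U
      ≤f U with b ∈? U | a ∈? U
      ... | no b∉U  | _       = ≤-trans (xSum-transfer-∉ b∉U) (x≤f U)
      ... | yes b∈U | yes a∈U = ≤-trans (≤-reflexive (xSum-transfer-∈∈ a∈U b∈U)) (x≤f U)
      ... | yes b∈U | no a∉U  =
        ≤-trans (≤-reflexive (xSum-transfer-∉∈ a∉U b∈U)) (≤∧≢⇒< (x≤f U) (untight U b∈U a∉U))

    -- Moving a unit of x from u to g is blocked only by x-tight sets containing g but
    -- not u, all contained in S; moving a unit of y from g to u only by y-tight sets
    -- containing u but not g, all containing T. So any g ∈ T ─ S with x g < y g works,
    -- and one exists: submodularity gives x(T ─ S) ≤ y(T ─ S), while u ∈ T ─ S and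
    -- y u < x u.
    module Exchange {d} {x y : Fin m → ℕ} (x∈B : InBase f d x) (y∈B : InBase f d y) (u : Fin m)
      where

      private
        x≤f : ∀ U → xSum x U ≤ f U
        x≤f = proj₁ x∈B

        y≤f : ∀ U → xSum y U ≤ f U
        y≤f = proj₁ y∈B

      S : Subset m
      S = ⋃ (filter (λ U → (xSum x U ≟ f U) ×-dec ¬? (u ∈? U)) (subsets m))

      T : Subset m
      T = ⋂ (filter (λ U → (xSum y U ≟ f U) ×-dec (u ∈? U)) (subsets m))

      S-tight : Tight x S × u ∉ S
      S-tight = ⋃-preserves (λ A → Tight x A × u ∉ A) (tight-⊥ x , ∉⊥)
        (λ (tA , u∉A) (tB , u∉B) →
           proj₁ (tight-∪∩ x≤f tA tB) , [ u∉A , u∉B ] ∘ x∈p∪q⁻ _ _)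
        (all-filter _ (subsets m))

      -- T is ⊤ when no y-tight set contains u.
      T-tight : (T ≡ ⊤ ⊎ Tight y T) × u ∈ T
      T-tight = ⋂-preserves (λ A → (A ≡ ⊤ ⊎ Tight y A) × u ∈ A) (inj₁ refl , ∈⊤)
        (λ (tA , u∈A) (tB , u∈B) → ∩-tight tA tB , x∈p∩q⁺ (u∈A , u∈B))
        (all-filter _ (subsets m))
        where
        ∩-tight : ∀ {A B} → Tight y A → B ≡ ⊤ ⊎ Tight y B → A ∩ B ≡ ⊤ ⊎ Tight y (A ∩ B)
        ∩-tight {A} tA (inj₁ refl) = inj₂ (subst (Tight y) (sym (∩-identityʳ A)) tA)
        ∩-tight     tA (inj₂ tB)   = inj₂ (proj₂ (tight-∪∩ y≤f tA tB))

      ⊆-S : ∀ {U} → Tight x U → u ∉ U → U ⊆ S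
      ⊆-S {U} tU u∉U = ⊆-⋃ (∈-filter⁺ _ (∈-subsets U) (tU , u∉U))

      T-⊆ : ∀ {U} → Tight y U → u ∈ U → T ⊆ U
      T-⊆ {U} tU u∈U = ⋂-⊆ (∈-filter⁺ _ (∈-subsets U) (tU , u∈U))

      cross-≤ : xSum x (T ∪ S) + xSum y (T ∩ S) ≤ xSum y T + xSum x S
      cross-≤ with proj₁ T-tight
      ... | inj₂ tT = begin
        xSum x (T ∪ S) + xSum y (T ∩ S)   ≤⟨ +-mono-≤ (x≤f (T ∪ S)) (y≤f (T ∩ S)) ⟩
        f (T ∪ S) + f (T ∩ S)             ≤⟨ submodular T S ⟩
        f T + f S                         ≡⟨ cong₂ _+_ tT (proj₁ S-tight) ⟨
        xSum y T + xSum x S               ∎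
        where open ≤-Reasoning
      ... | inj₁ T≡⊤ rewrite T≡⊤ | ∪-zeroˡ S | ∩-identityˡ S = begin
        xSum x ⊤ + xSum y S               ≤⟨ +-monoʳ-≤ (xSum x ⊤) (y≤f S) ⟩
        xSum x ⊤ + f S                    ≡⟨ cong₂ _+_ (trans (proj₂ x∈B) (sym (proj₂ y∈B)))
                                                       (sym (proj₁ S-tight)) ⟩
        xSum y ⊤ + xSum x S               ∎
        where open ≤-Reasoning

      x≤y-on-T─S : xSum x (T ─ S) ≤ xSum y (T ─ S)
      x≤y-on-T─S = +-cancelˡ-≤ (xSum x S + xSum y (T ∩ S)) _ _ (begin
        xSum x S + xSum y (T ∩ S) + xSum x (T ─ S)   ≡⟨ xy∙z≈xz∙y (xSum x S) _ _ ⟩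
        xSum x S + xSum x (T ─ S) + xSum y (T ∩ S)   ≡⟨ cong (_+ xSum y (T ∩ S)) (xSum-∪ T S) ⟩
        xSum x (T ∪ S) + xSum y (T ∩ S)              ≤⟨ cross-≤ ⟩
        xSum y T + xSum x S                          ≡⟨ cong (_+ xSum x S) (xSum-∩ T S) ⟨
        xSum y (T ∩ S) + xSum y (T ─ S) + xSum x S   ≡⟨ xy∙z≈zx∙y (xSum y (T ∩ S)) _ _ ⟩
        xSum x S + xSum y (T ∩ S) + xSum y (T ─ S)   ∎)
        where open ≤-Reasoning

      exchange : y u < x u →
                 ∃[ g ] x g < y g × InBase f d (transfer x u g) × InBase f d (transfer y g u)
      exchange yu<xu with any? (λ g → (x g <? y g) ×-dec (g ∈? T ─ S))
      ... | yes (g , xg<yg , g∈T─S) =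
        g , xg<yg ,
        transfer-feasible x∈B (≤-trans (s≤s z≤n) yu<xu)
          (λ U g∈U u∉U tU → g∉S (⊆-S tU u∉U g∈U)) ,
        transfer-feasible y∈B (≤-trans (s≤s z≤n) xg<yg)
          (λ U u∈U g∉U tU → g∉U (T-⊆ tU u∈U g∈T))
        where
        g∈T : g ∈ T
        g∈T = proj₁ (x∈p─q⁻ T S g∈T─S)
        g∉S : g ∉ S
        g∉S = proj₂ (x∈p─q⁻ T S g∈T─S)
      ... | no no-candidate = ⊥-elim (<⇒≱ y<x-on-T─S x≤y-on-T─S)
        where
        y≤x-on-T─S : ∀ w → w ∈ T ─ S → y w ≤ x w
        y≤x-on-T─S w w∈T─S = ≮⇒≥ (λ xw<yw → no-candidate (w , xw<yw , w∈T─S))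
        y<x-on-T─S : xSum y (T ─ S) < xSum x (T ─ S)
        y<x-on-T─S = xSum-< y≤x-on-T─S (x∈p∧x∉q⇒x∈p─q (proj₂ T-tight) (proj₂ S-tight)) yu<xu

    open Exchange using (exchange) public

    inBase? : ∀ d x → Dec (InBase f d x)
    inBase? d x = below-f? ×-dec (xSum x ⊤ ≟ d)
      where
      below-f? : Dec (∀ U → xSum x U ≤ f U)
      below-f? = map′ (λ x≤f U → All.lookup x≤f (∈-subsets U))
                      (λ x≤f → All.tabulate (λ {U} _ → x≤f U))
                      (All.all? (λ U → xSum x U ≤? f U) (subsets m))

module OrderedGroupProperties {c ℓ} (G : OrderedAbelianGroup c ℓ) where

  open OrderedAbelianGroup G
  open import Data.Nat as ℕ using (ℕ; suc; _≤′_; ≤′-refl; ≤′-step)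
  open import Data.Fin as Fin using (Fin; zero)
  open import Function using (_∘_)
  open import Algebra.Bundles using (CommutativeSemigroup)
  open import Algebra.Structures using (IsAbelianGroup)
  open import Relation.Binary.Structures using (IsTotalOrder)
  open import Relation.Binary.Bundles using (TotalOrder)
  import Relation.Binary.Reasoning.PartialOrder as PartialOrderReasoning
  open import Relation.Binary.PropositionalEquality

  private
    module +G = IsAbelianGroup isAbelianGroup
    module ≤G = IsTotalOrder isTotalOrder

  ≤-totalOrder : TotalOrder c c ℓ
  ≤-totalOrder = record { Carrier = Carrier ; _≈_ = _≡_ ; _≤_ = _≤_ ; isTotalOrder = isTotalOrder }

  module ≤-Reasoning = PartialOrderReasoning (TotalOrder.poset ≤-totalOrder)

  +-commutativeSemigroup : CommutativeSemigroup c c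
  +-commutativeSemigroup = record
    { Carrier = Carrier ; _≈_ = _≡_ ; _∙_ = _+_
    ; isCommutativeSemigroup = +G.isCommutativeSemigroup }

  open import Algebra.Properties.CommutativeSemigroup +-commutativeSemigroup using (interchange)

  +-monoʳ-≤ : ∀ a {b c} → b ≤ c → a + b ≤ a + c
  +-monoʳ-≤ a {b} {c} b≤c = subst₂ _≤_ (+G.comm b a) (+G.comm c a) (+-monoˡ-≤ a b≤c)

  +-mono-≤ : ∀ {a b c d} → a ≤ b → c ≤ d → a + c ≤ b + d
  +-mono-≤ {b = b} {c} a≤b c≤d = ≤G.trans (+-monoˡ-≤ c a≤b) (+-monoʳ-≤ b c≤d)

  +-cancelʳ-≤ : ∀ k {a b} → a + k ≤ b + k → a ≤ b
  +-cancelʳ-≤ k {a} {b} a+k≤b+k =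
    subst₂ _≤_ (+-−-cancel a) (+-−-cancel b) (+-monoˡ-≤ (- k) a+k≤b+k)
    where
    +-−-cancel : ∀ a → a + k - k ≡ a
    +-−-cancel a =
      trans (+G.assoc a k (- k)) (trans (cong (a +_) (+G.inverseʳ k)) (+G.identityʳ a))

  +-cancelˡ-≤ : ∀ k {a b} → k + a ≤ k + b → a ≤ b
  +-cancelˡ-≤ k {a} {b} k+a≤k+b =
    +-cancelʳ-≤ k (subst₂ _≤_ (+G.comm k a) (+G.comm k b) k+a≤k+b)

  −+-cancel : ∀ a b c → a - b + (b + c) ≡ a + c
  −+-cancel a b c = begin
    a + - b + (b + c)     ≡⟨ +G.assoc a (- b) (b + c) ⟩
    a + (- b + (b + c))   ≡⟨ cong (a +_) (+G.assoc (- b) b c) ⟨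
    a + (- b + b + c)     ≡⟨ cong (λ z → a + (z + c)) (+G.inverseˡ b) ⟩
    a + (0# + c)          ≡⟨ cong (a +_) (+G.identityˡ c) ⟩
    a + c                 ∎
    where open ≡-Reasoning

  −+-cancel′ : ∀ a b c → a - b + (c + b) ≡ a + c
  −+-cancel′ a b c = trans (cong (a - b +_) (+G.comm c b)) (−+-cancel a b c)

  −≤−⇒+≤+ : ∀ {a b c d} → a - b ≤ c - d → a + d ≤ c + b
  −≤−⇒+≤+ {a} {b} {c} {d} a-b≤c-d =
    subst₂ _≤_ (−+-cancel a b d) (−+-cancel′ c d b) (+-monoˡ-≤ (b + d) a-b≤c-d)

  +≤+⇒−≤− : ∀ {a b c d} → a + d ≤ c + b → a - b ≤ c - d
  +≤+⇒−≤− {a} {b} {c} {d} a+d≤c+b = +-cancelʳ-≤ (b + d)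
    (subst₂ _≤_ (sym (−+-cancel a b d)) (sym (−+-cancel′ c d b)) a+d≤c+b)

  −≤−-swap : ∀ {a b c d} → a - b ≤ c - d → d - b ≤ c - a
  −≤−-swap {a} {b} {c} {d} a-b≤c-d =
    +≤+⇒−≤− (subst (_≤ c + b) (+G.comm a d) (−≤−⇒+≤+ a-b≤c-d))

  nondecreasing : ∀ {φ : ℕ → Carrier} → (∀ i → φ i ≤ φ (suc i)) → ∀ {j k} → j ≤′ k → φ j ≤ φ k
  nondecreasing step ≤′-refl         = ≤G.refl
  nondecreasing step (≤′-step j≤′k) = ≤G.trans (nondecreasing step j≤′k) (step _)

  gsum-+ : ∀ {m} (p q : Fin m → Carrier) → gsum G (λ v → p v + q v) ≡ gsum G p + gsum G q
  gsum-+ {ℕ.zero}  p q = sym (+G.identityʳ 0#)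
  gsum-+ {ℕ.suc m} p q =
    trans (cong (p zero + q zero +_) (gsum-+ (p ∘ Fin.suc) (q ∘ Fin.suc))) (interchange _ _ _ _)

  gsum-mono : ∀ {m} {p q : Fin m → Carrier} → (∀ v → p v ≤ q v) → gsum G p ≤ gsum G q
  gsum-mono {ℕ.zero}  p≤q = ≤G.refl
  gsum-mono {ℕ.suc m} p≤q = +-mono-≤ (p≤q zero) (gsum-mono (p≤q ∘ Fin.suc))

module RegularCosts {c ℓ} (G : OrderedAbelianGroup c ℓ) where

  open OrderedAbelianGroup G
  open OrderedGroupProperties G
  open AdjacentTimes using (Adjacent; same; later; earlier; Adjacent-sym)
  open Transfers using (transfer; transfer-src; transfer-tgt; transfer-other)
  open import Data.Nat as ℕ using (ℕ; suc; _∸_; s≤s)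
  open import Data.Nat.Properties using (≤⇒≤′; <-asym)
  open import Data.Fin using (Fin; _≟_)
  open import Data.Product using (proj₁; proj₂)
  open import Data.Sum using (_⊎_; inj₁; inj₂)
  open import Function using (_∘_)
  open import Relation.Binary.PropositionalEquality
  open import Relation.Nullary using (yes; no)
  open import Algebra.Structures using (IsAbelianGroup)
  open import Relation.Binary.Structures using (IsTotalOrder)

  private
    module +G = IsAbelianGroup isAbelianGroup
    module ≤G = IsTotalOrder isTotalOrder

  module _ {K : ℕ → ℕ → Carrier} (regular : Regular G K) where

    Cminus-convex : ∀ k τ → Cminus G K k τ ≤ Cminus G K (suc k) τ
    Cminus-convex k τ = ≤G.trans (proj₁ (regular k τ)) (proj₂ (regular k τ))

    Cminus-adjacent : ∀ {τ τ′} → Adjacent τ τ′ → ∀ k → Cminus G K k τ′ ≤ Cminus G K (suc k) τ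
    Cminus-adjacent same    k = Cminus-convex k _
    Cminus-adjacent later   k = proj₂ (regular k _)
    Cminus-adjacent earlier k = ≤G.trans (Cminus-convex k _) (proj₁ (regular (suc k) _))

    unit-transfer-≤ : ∀ {τ τ′} → Adjacent τ τ′ → ∀ {j k} → j ℕ.< k →
                      K (suc j) τ + K (k ∸ 1) τ′ ≤ K k τ + K j τ′
    unit-transfer-≤ adjacent {k = suc k} (s≤s j≤k) =
      −≤−⇒+≤+ (nondecreasing (λ i → −≤−-swap (Cminus-adjacent adjacent i)) (≤⇒≤′ j≤k))

  module _ {m} (C : Fin m → ℕ → ℕ → Carrier) where

    cost-comparison : ∀ {t t′ x y z w : Fin m → ℕ} → cost G C t x ≤ cost G C t w →
      (∀ v → C v (w v) (t v) + C v (z v) (t′ v) ≤ C v (x v) (t v) + C v (y v) (t′ v)) →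
      cost G C t′ z ≤ cost G C t′ y
    cost-comparison {t} {t′} {x} {y} {z} {w} x≤w pointwise = +-cancelˡ-≤ (cost G C t w) (begin
      cost G C t w + cost G C t′ z                          ≡⟨ gsum-+ (λ v → C v (w v) (t v)) _ ⟨
      gsum G (λ v → C v (w v) (t v) + C v (z v) (t′ v))     ≤⟨ gsum-mono pointwise ⟩
      gsum G (λ v → C v (x v) (t v) + C v (y v) (t′ v))     ≡⟨ gsum-+ (λ v → C v (x v) (t v)) _ ⟩
      cost G C t x + cost G C t′ y                          ≤⟨ +-monoˡ-≤ (cost G C t′ y) x≤w ⟩
      cost G C t w + cost G C t′ y                          ∎)
      where open ≤-Reasoning

    pointwise-unchanged : ∀ {t t′ x y : Fin m → ℕ} v → t v ≡ t′ v ⊎ x v ≡ y v →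
      C v (y v) (t v) + C v (x v) (t′ v) ≤ C v (x v) (t v) + C v (y v) (t′ v)
    pointwise-unchanged v (inj₁ tv≡t′v) rewrite tv≡t′v = ≤G.reflexive (+G.comm _ _)
    pointwise-unchanged v (inj₂ xv≡yv)  rewrite xv≡yv  = ≤G.refl

    private
      distinct : ∀ {x y : Fin m → ℕ} {a b} → y a ℕ.< x a → x b ℕ.< y b → a ≢ b
      distinct ya<xa xb<ya refl = <-asym ya<xa xb<ya

    pointwise-transfer : (∀ v → Regular G (C v)) → ∀ {t t′ x y : Fin m → ℕ} {a b} →
      y a ℕ.< x a → x b ℕ.< y b →
      (∀ v → Adjacent (t v) (t′ v)) → (∀ v → v ≢ a → v ≢ b → t v ≡ t′ v) →
      ∀ v → C v (transfer y b a v) (t v) + C v (transfer x a b v) (t′ v)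
          ≤ C v (x v) (t v) + C v (y v) (t′ v)
    pointwise-transfer regular {t} {t′} {x} {y} {a} {b} ya<xa xb<yb adjacent agree v
      with distinct {x = x} {y} {a} {b} ya<xa xb<yb | v ≟ a | v ≟ b
    ... | a≢b | yes refl | _
      rewrite transfer-tgt {x = y} (a≢b ∘ sym) | transfer-src {x = x} a≢b =
        unit-transfer-≤ (regular v) (adjacent v) ya<xa
    ... | a≢b | no v≢a | yes refl
      rewrite transfer-src {x = y} (a≢b ∘ sym) | transfer-tgt {x = x} a≢b =
        subst₂ _≤_ (+G.comm _ _) (+G.comm _ _)
          (unit-transfer-≤ (regular v) (Adjacent-sym (adjacent v)) xb<yb)
    ... | _   | no v≢a | no v≢b
      rewrite transfer-other {x = y} v≢b v≢a | transfer-other {x = x} v≢a v≢b =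
        pointwise-unchanged {t} {t′} {x} {y} v (inj₁ (agree v v≢a v≢b))

open import Data.Nat using (ℕ; suc; _≤_; _<_)
open import Data.Fin using (Fin)
open import Data.Fin.Subset using (Subset)
open import Data.Product using (Σ; _×_; _,_; proj₂)
open import Relation.Binary.PropositionalEquality using (_≡_; _≢_)
open AdjacentTimes using (Adjacent; dist₁≡1⇒unit-change)

module Reoptimization
  {c ℓ} (G : OrderedAbelianGroup c ℓ)
  {m} (f : Subset m → ℕ) (polymatroid : IsPolymatroidRank f) (d : ℕ)
  (C : Fin m → ℕ → ℕ → OrderedAbelianGroup.Carrier G) (regular : ∀ v → Regular G (C v))
  (t t′ x : Fin m → ℕ) (x-optimal : Optimal G f d C t x)
  (e : Fin m) (adjacent-at-e : Adjacent (t e) (t′ e)) (agree : ∀ v → v ≢ e → t v ≡ t′ v)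
  where

  open AdjacentTimes using (same)
  open Transfers using (transfer; dist₁-refl; dist₁-transfer)
  open Polymatroid using (inBase?; exchange)
  open OrderedGroupProperties G using (≤-totalOrder)
  open RegularCosts G using (cost-comparison; pointwise-unchanged; pointwise-transfer)
  open OrderedAbelianGroup G using () renaming (Carrier to A; _≤_ to _≤ᴳ_)
  open import Data.Nat using (z≤n; <-cmp)
  open import Data.Fin using (_≟_)
  open import Data.List using (List; filter; cartesianProductWith; allFin)
  open import Data.List.Membership.Propositional using (_∈_; lose)
  open import Data.List.Membership.Propositional.Properties
    using (∈-filter⁺; ∈-filter⁻; ∈-cartesianProductWith⁺; ∈-cartesianProductWith⁻; ∈-allFin)
  open import Data.List.Relation.Unary.Any using (Any)
  open import Data.List.Relation.Unary.All using (All; tabulate)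
  open import Data.List.Extrema ≤-totalOrder using (argmin; argmin-all; f[argmin]≤v⁺)
  open import Data.Product using (proj₁)
  open import Data.Sum using (_⊎_; inj₁; inj₂)
  open import Relation.Binary.Definitions using (tri<; tri≈; tri>)
  open import Relation.Binary.PropositionalEquality using (refl; sym; subst)
  open import Relation.Nullary using (yes; no)

  private
    cost′ : (Fin m → ℕ) → A
    cost′ = cost G C t′

    x∈B : InBase f d x
    x∈B = proj₁ x-optimal

    x-minimal : ∀ y → InBase f d y → cost G C t x ≤ᴳ cost G C t y
    x-minimal = proj₂ x-optimal

  adjacent : ∀ v → Adjacent (t v) (t′ v)
  adjacent v with v ≟ e
  ... | yes refl = adjacent-at-e
  ... | no v≢e   = subst (Adjacent (t v)) (agree v v≢e) same

  candidates : List (Fin m → ℕ)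
  candidates =
    filter (inBase? f polymatroid d) (cartesianProductWith (transfer x) (allFin m) (allFin m))

  ∈-candidates : ∀ a b → InBase f d (transfer x a b) → transfer x a b ∈ candidates
  ∈-candidates a b =
    ∈-filter⁺ (inBase? f polymatroid d)
      (∈-cartesianProductWith⁺ (transfer x) (∈-allFin a) (∈-allFin b))

  candidates-nearby : All (λ z → InBase f d z × dist₁ x z ≤ 2) candidates
  candidates-nearby = tabulate nearby
    where
    nearby : ∀ {z} → z ∈ candidates → InBase f d z × dist₁ x z ≤ 2
    nearby z∈ with ∈-filter⁻ (inBase? f polymatroid d) z∈
    ... | z∈transfers , z∈B
      with ∈-cartesianProductWith⁻ (transfer x) (allFin m) (allFin m) z∈transfers
    ...   | a , b , _ , _ , refl = z∈B , dist₁-transfer x a b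

  transfer-candidate-≤ : ∀ {y a b} → y a < x a → x b < y b →
    (∀ v → v ≢ a → v ≢ b → t v ≡ t′ v) →
    InBase f d (transfer x a b) → InBase f d (transfer y b a) →
    Any (λ z → cost′ z ≤ᴳ cost′ y) candidates
  transfer-candidate-≤ {a = a} {b} ya<xa xb<yb agree-off z∈B w∈B =
    lose (∈-candidates a b z∈B) (cost-comparison C (x-minimal _ w∈B)
      (pointwise-transfer C regular ya<xa xb<yb adjacent agree-off))

  candidate-≤ : ∀ {y} → InBase f d y →
                cost′ x ≤ᴳ cost′ y ⊎ Any (λ z → cost′ z ≤ᴳ cost′ y) candidates
  candidate-≤ {y} y∈B with <-cmp (y e) (x e)
  ... | tri≈ _ ye≡xe _ = inj₁ (cost-comparison C (x-minimal y y∈B)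
    (λ v → pointwise-unchanged C {t} {t′} {x} {y} v (agree-or-equal v)))
    where
    agree-or-equal : ∀ v → t v ≡ t′ v ⊎ x v ≡ y v
    agree-or-equal v with v ≟ e
    ... | yes refl = inj₂ (sym ye≡xe)
    ... | no v≢e   = inj₁ (agree v v≢e)
  ... | tri< ye<xe _ _ with exchange f polymatroid x∈B y∈B e ye<xe
  ...   | g , xg<yg , z∈B , w∈B =
    inj₂ (transfer-candidate-≤ ye<xe xg<yg (λ v v≢e _ → agree v v≢e) z∈B w∈B)
  candidate-≤ {y} y∈B | tri> _ _ xe<ye with exchange f polymatroid y∈B x∈B e xe<ye
  ...   | g , yg<xg , w∈B , z∈B =
    inj₂ (transfer-candidate-≤ yg<xg xe<ye (λ v _ v≢e → agree v v≢e) z∈B w∈B)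

  x′ : Fin m → ℕ
  x′ = argmin cost′ x candidates

  x′-nearby : InBase f d x′ × dist₁ x x′ ≤ 2
  x′-nearby = argmin-all cost′ (x∈B , subst (_≤ 2) (sym (dist₁-refl x)) z≤n) candidates-nearby

  x′-optimal : Optimal G f d C t′ x′
  x′-optimal = proj₁ x′-nearby , λ y y∈B → f[argmin]≤v⁺ x candidates (candidate-≤ y∈B)

corollary3p3 : ∀ {c ℓ} (G : OrderedAbelianGroup c ℓ) (n : ℕ) (f : Subset (suc n) → ℕ) (d : ℕ)
    → IsPolymatroidRank f
    → Σ (Fin (suc n) → ℕ) (InBase f d)
    → (C : Fin (suc n) → ℕ → ℕ → OrderedAbelianGroup.Carrier G)
    → (∀ e → Regular G (C e))
    → (∀ e → Nonneg G (C e))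
    → ∀ (t x : Fin (suc n) → ℕ) → Optimal G f d C t x
    → ∀ (t′ : Fin (suc n) → ℕ) → dist₁ t t′ ≡ 1
    → Σ (Fin (suc n) → ℕ) (λ x′ → Optimal G f d C t′ x′ × dist₁ x x′ ≤ 2)
corollary3p3 G n f d polymatroid _ C regular _ t x x-optimal t′ t~t′
  with dist₁≡1⇒unit-change t t′ t~t′
... | e , adjacent-at-e , agree = x′ , x′-optimal , proj₂ x′-nearby
  where open Reoptimization G f polymatroid d C regular t t′ x x-optimal e adjacent-at-e agree
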